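{- For $n\ge 1$, $$A_n(x)=\sum_{Y_n\in\mathcal{Y}_n}\left(\frac12\right)^{\mathrm{neg}(Y_n)+\mathrm{pos}(Y_n)}x^{\mathrm{pos}(Y_n)},$$ equivalently $$2^nA_n(x)=\sum_{Y_n\in\mathcal{Y}_n}2^{\mathrm{star}(Y_n)}x^{\mathrm{pos}(Y_n)}.$$
   Context: $A_n(x)=\sum_{\pi\in\mathfrak{S}_n}x^{\mathrm{exc}(\pi)}$ is the Eulerian polynomial, where $\mathrm{exc}(\pi)$ is the number of $i\in[n]$ with $\pi(i)>i$. For $k\ge1$, $\ell\ge0$ let $P_k=\{1,2,\dots,2k\}$ and $N_\ell=\{ -1,-2,\dots,-2\ell,\star\}$, where $\star$ is a formal symbol. For a sequence $Y=(y_1,\dots,y_m)$ with entries in $\mathbb{Z}\cup\{\star\}$, $\mathrm{pos}(Y)$, $\mathrm{neg}(Y)$, $\mathrm{star}(Y)$ denote the numbers of positive entries, negative entries and entries equal to $\star$. A sequence $Y_n=(y_1,\dots,y_n)$ is an MY-sequence of length $n$ if $y_1=\star$ and, for $2\le k\le n$, $y_k\in P_{1+s_k}\cup N_{t_k}$, where $s_k=\mathrm{neg}(Y_{k-1})+\mathrm{star}(Y_{k-1})-1$, $t_k=\mathrm{pos}(Y_{k-1})$, and $Y_{k-1}=(y_1,\dots,y_{k-1})$. $\mathcal{Y}_n$ is the set of MY-sequences of length $n$. -}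

module Defs where

open import Data.Nat using (ℕ; zero; suc; _+_; _*_; _∸_; _^_; _<?_)
open import Data.Integer as ℤ using (ℤ; +_; -[1+_])
open import Data.Fin using (Fin; toℕ)
open import Data.Fin.Properties using (_≟_)
open import Data.Vec using (Vec; []; _∷_; lookup; toList)
open import Data.List using (List; []; _∷_; _++_; [_]; map; concatMap; filter; length; allFin; upTo)
open import Data.Nat.ListAction using (sum)
import Data.List.Relation.Unary.Unique.DecPropositional as UniqueDec
open import Relation.Nullary.Decidable using (Dec; yes; no)
open import Relation.Binary.PropositionalEquality using (_≡_)

-- Generating polynomials, represented by their coefficients.
-- coeff L deg w j  =  coefficient of x^j in  Σ_{a ∈ L} w(a) x^{deg(a)}.

coeff : {A : Set} → List A → (A → ℕ) → (A → ℕ) → ℕ → ℕ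
coeff L deg w j = sum (map w (filter (λ a → deg a Data.Nat.≟ j) L))

-- Permutations of [n] = {0,…,n-1} (0-indexed copy of {1,…,n}),
-- represented as the vector (π(0),…,π(n-1)) with pairwise distinct entries.

allVecs : (m k : ℕ) → List (Vec (Fin k) m)
allVecs zero    k = [] ∷ []
allVecs (suc m) k = concatMap (λ i → map (i ∷_) (allVecs m k)) (allFin k)

Perm : ℕ → Set
Perm n = Vec (Fin n) n

Sym : (n : ℕ) → List (Perm n)
Sym n = filter (λ v → UniqueDec.unique? _≟_ (toList v)) (allVecs n n)

exc : {n : ℕ} → Perm n → ℕ
exc {n} π = length (filter (λ i → toℕ i <? toℕ (lookup π i)) (allFin n))

eulerianCoeff : ℕ → ℕ → ℕ
eulerianCoeff n j = coeff (Sym n) exc (λ _ → 1) j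

data Entry : Set where
  num : ℤ → Entry
  ⋆   : Entry

posE : Entry → ℕ
posE (num (+ suc _)) = 1
posE _               = 0

negE : Entry → ℕ
negE (num -[1+ _ ]) = 1
negE _              = 0

starE : Entry → ℕ
starE ⋆ = 1
starE _ = 0

pos neg star : List Entry → ℕ
pos  Y = sum (map posE Y)
neg  Y = sum (map negE Y)
star Y = sum (map starE Y)

P : ℕ → List Entry
P k = map (λ i → num (+ suc i)) (upTo (2 * k))

N : ℕ → List Entry
N ℓ = map (λ i → num -[1+ i ]) (upTo (2 * ℓ)) ++ [ ⋆ ]

-- allowed values of y_k given Y_{k-1}:  P_{1+s_k} ∪ N_{t_k},
-- s_k = neg(Y_{k-1}) + star(Y_{k-1}) - 1,  t_k = pos(Y_{k-1})
-- (P and N are disjoint, so concatenation is the union)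
allowed : List Entry → List Entry
allowed Y = P (1 + (neg Y + star Y ∸ 1)) ++ N (pos Y)

MY : ℕ → List (List Entry)
MY zero          = []
MY (suc zero)    = [ ⋆ ∷ [] ]
MY (suc (suc m)) = concatMap (λ Y → map (λ y → Y ++ [ y ]) (allowed Y)) (MY (suc m))

module Submission where

-- Both coefficient sequences obey the Eulerian recurrence
--   c_{n+1}(0) = c_n(0),   c_{n+1}(i+1) = (i+2)·c_n(i+1) + (n-i)·c_n(i),
-- written  c_{n+1} = eulerStep n c_n  (the MY side gains a factor 2 per step,
-- matching the factor 2 of 2ⁿ).  The general fact behind both is
-- ∑-stepWeight : if every object of statistic p has children whose statistic
-- has generating polynomial (p+1)·x^p + (n-p)·x^{p+1}, the children's
-- coefficients are eulerStep n of the parents' coefficients.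
--  * Permutations: inserting a new point 0 is a bijection 𝔖_n × [n+1] ≅ 𝔖_{n+1},
--    and the n+1 insertions into π have exactly this excedance profile.
--  * MY-sequences: Y ∈ 𝒴_{m+1} has pos + neg + star = m+1 and star ≥ 1, so its
--    2(m+1-pos) + 2·pos + 1 extensions carry twice this profile in pos.

open import Defs
open import Data.Nat as ℕ using (ℕ; zero; suc; _+_; _*_; _∸_; _^_; _≤_; _<_; _<?_; z≤n; s≤s)
open import Data.Nat.Properties
open import Data.Nat.ListAction using (sum)
open import Data.Nat.ListAction.Properties using (sum-↭)
open import Data.Nat.Tactic.RingSolver using (solve-∀)
open import Data.Integer using () renaming (+_ to ℤ⁺; -[1+_] to ℤ⁻)
open import Data.Fin using (Fin; zero; suc; toℕ)
import Data.Fin.Properties as FinP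
open import Data.Vec using (Vec; []; _∷_; lookup; tabulate; toList)
import Data.Vec.Properties as VecP
import Data.List as List
open import Data.List using (List; []; _∷_; _++_; [_]; map; concatMap; filter; length; allFin; upTo; cartesianProductWith)
open import Data.List.Properties using (length-upTo; length-tabulate)
open import Data.List.Relation.Unary.All as All using (All; []; _∷_)
import Data.List.Relation.Unary.All.Properties as AllP
open import Data.List.Relation.Unary.Any using (here)
open import Data.List.Relation.Unary.Unique.Propositional using (Unique)
import Data.List.Relation.Unary.AllPairs as AllPairs
import Data.List.Relation.Unary.Unique.Propositional.Properties as UniqueP
import Data.List.Relation.Unary.Unique.DecPropositional as UniqueDec
open import Data.List.Membership.Propositional using (_∈_)
open import Data.List.Membership.Propositional.Properties
  using (∈-filter⁺; ∈-filter⁻; ∈-cartesianProductWith⁺; ∈-cartesianProductWith⁻; ∈-allFin)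
open import Data.List.Membership.Propositional.Properties.WithK using (unique∧set⇒bag)
open import Data.List.Relation.Binary.BagAndSetEquality using (∼bag⇒↭)
open import Data.List.Relation.Binary.Permutation.Propositional using (_↭_)
import Data.List.Relation.Binary.Permutation.Propositional.Properties as PermP
open import Data.Product using (Σ; ∃; _×_; _,_; proj₂)
open import Data.Sum using (_⊎_; inj₁; inj₂)
open import Data.Empty using (⊥; ⊥-elim)
open import Function.Bundles using (mk⇔)
open import Function.Definitions using (Injective)
open import Relation.Nullary using (¬_)
open import Relation.Nullary.Decidable using (Dec; yes; no)
open import Relation.Binary.PropositionalEquality
  using (_≡_; refl; sym; trans; cong; cong₂; subst; module ≡-Reasoning)


-- Weighted sums over a list.  ∑ xs f = Σ_{a ∈ xs} f a; it unfolds
-- definitionally, so  pos Y = ∑ Y posE  and  coeff L deg w j = ∑ (filter …) w.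
∑ : {A : Set} → List A → (A → ℕ) → ℕ
∑ xs f = sum (map f xs)

𝟙 : {P : Set} → Dec P → ℕ
𝟙 (yes _) = 1
𝟙 (no _)  = 0

𝟙-yes : {P : Set} (d : Dec P) → P → 𝟙 d ≡ 1
𝟙-yes (yes _) _ = refl
𝟙-yes (no ¬p) p = ⊥-elim (¬p p)

𝟙-⇔ : {P Q : Set} (d : Dec P) (e : Dec Q) → (P → Q) → (Q → P) → 𝟙 d ≡ 𝟙 e
𝟙-⇔ (yes _) (yes _) _ _ = refl
𝟙-⇔ (yes p) (no ¬q) f _ = ⊥-elim (¬q (f p))
𝟙-⇔ (no ¬p) (yes q) _ g = ⊥-elim (¬p (g q))
𝟙-⇔ (no _)  (no _)  _ _ = refl

𝟙-01 : {P : Set} (d : Dec P) → (𝟙 d ≡ 0) ⊎ (𝟙 d ≡ 1)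
𝟙-01 (yes _) = inj₂ refl
𝟙-01 (no _)  = inj₁ refl

𝟙-subst : (x k : ℕ) (f : ℕ → ℕ) → f x * 𝟙 (x ℕ.≟ k) ≡ f k * 𝟙 (x ℕ.≟ k)
𝟙-subst x k f with x ℕ.≟ k
... | yes refl = refl
... | no _     = trans (*-zeroʳ (f x)) (sym (*-zeroʳ (f k)))

𝟙-suc : (x k : ℕ) → 𝟙 (suc x ℕ.≟ suc k) ≡ 𝟙 (x ℕ.≟ k)
𝟙-suc x k = 𝟙-⇔ _ _ suc-injective (cong suc)

∑-filter : {A : Set} {P : A → Set} (P? : (a : A) → Dec (P a)) (xs : List A) (w : A → ℕ) →
  ∑ (filter P? xs) w ≡ ∑ xs (λ a → 𝟙 (P? a) * w a)
∑-filter P? [] w = refl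
∑-filter P? (x ∷ xs) w with P? x
... | yes _ = cong₂ _+_ (sym (+-identityʳ (w x))) (∑-filter P? xs w)
... | no _  = ∑-filter P? xs w

coeff-∑ : {A : Set} (L : List A) (deg w : A → ℕ) (j : ℕ) →
  coeff L deg w j ≡ ∑ L (λ a → 𝟙 (deg a ℕ.≟ j) * w a)
coeff-∑ L deg w j = ∑-filter (λ a → deg a ℕ.≟ j) L w

length-filter-∑ : {A : Set} {P : A → Set} (P? : (a : A) → Dec (P a)) (xs : List A) →
  length (filter P? xs) ≡ ∑ xs (λ a → 𝟙 (P? a))
length-filter-∑ P? [] = refl
length-filter-∑ P? (x ∷ xs) with P? x
... | yes _ = cong suc (length-filter-∑ P? xs)
... | no _  = length-filter-∑ P? xs

∑-++ : {A : Set} (xs ys : List A) (f : A → ℕ) → ∑ (xs ++ ys) f ≡ ∑ xs f + ∑ ys f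
∑-++ [] ys f = refl
∑-++ (x ∷ xs) ys f = trans (cong (f x +_) (∑-++ xs ys f)) (sym (+-assoc (f x) _ _))

∑-map : {A B : Set} (g : A → B) (xs : List A) (f : B → ℕ) → ∑ (map g xs) f ≡ ∑ xs (λ a → f (g a))
∑-map g [] f = refl
∑-map g (x ∷ xs) f = cong (f (g x) +_) (∑-map g xs f)

∑-concatMap : {A B : Set} (h : A → List B) (xs : List A) (f : B → ℕ) →
  ∑ (concatMap h xs) f ≡ ∑ xs (λ a → ∑ (h a) f)
∑-concatMap h [] f = refl
∑-concatMap h (x ∷ xs) f =
  trans (∑-++ (h x) (concatMap h xs) f) (cong (∑ (h x) f +_) (∑-concatMap h xs f))

∑-cartesianProductWith : {A B C : Set} (g : A → B → C) (xs : List A) (ys : List B) (f : C → ℕ) →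
  ∑ (cartesianProductWith g xs ys) f ≡ ∑ xs (λ a → ∑ ys (λ b → f (g a b)))
∑-cartesianProductWith g [] ys f = refl
∑-cartesianProductWith g (x ∷ xs) ys f =
  trans (∑-++ (map (g x) ys) _ f) (cong₂ _+_ (∑-map (g x) ys f) (∑-cartesianProductWith g xs ys f))

∑-cong : {A : Set} (xs : List A) {f g : A → ℕ} → (∀ a → f a ≡ g a) → ∑ xs f ≡ ∑ xs g
∑-cong [] e = refl
∑-cong (x ∷ xs) e = cong₂ _+_ (e x) (∑-cong xs e)

∑-congAll : {A : Set} {xs : List A} {f g : A → ℕ} → All (λ a → f a ≡ g a) xs → ∑ xs f ≡ ∑ xs g
∑-congAll [] = refl
∑-congAll (e ∷ es) = cong₂ _+_ e (∑-congAll es)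

∑-+ : {A : Set} (xs : List A) (f g : A → ℕ) → ∑ xs (λ a → f a + g a) ≡ ∑ xs f + ∑ xs g
∑-+ [] f g = refl
∑-+ (x ∷ xs) f g = trans (cong (f x + g x +_) (∑-+ xs f g)) (interchange (f x) (g x) _ _)
  where
  interchange : ∀ a b c d → a + b + (c + d) ≡ a + c + (b + d)
  interchange = solve-∀

∑-* : {A : Set} (xs : List A) (c : ℕ) (f : A → ℕ) → ∑ xs (λ a → c * f a) ≡ c * ∑ xs f
∑-* [] c f = sym (*-zeroʳ c)
∑-* (x ∷ xs) c f = trans (cong (c * f x +_) (∑-* xs c f)) (sym (*-distribˡ-+ c (f x) _))

∑-const : {A : Set} (xs : List A) (c : ℕ) → ∑ xs (λ _ → c) ≡ length xs * c
∑-const [] c = refl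
∑-const (x ∷ xs) c = cong (c +_) (∑-const xs c)

∑-complement : {A : Set} (xs : List A) (g : A → ℕ) → (∀ a → (g a ≡ 0) ⊎ (g a ≡ 1)) →
  ∑ xs (λ a → 1 ∸ g a) ≡ length xs ∸ ∑ xs g
∑-complement xs g g01 = trans (sym (m+n∸n≡m (∑ xs (λ a → 1 ∸ g a)) (∑ xs g)))
  (cong (_∸ ∑ xs g) (trans (sym (∑-+ xs (λ a → 1 ∸ g a) g))
    (trans (∑-cong xs one) (trans (∑-const xs 1) (*-identityʳ (length xs))))))
  where
  one : ∀ a → 1 ∸ g a + g a ≡ 1
  one a with g01 a
  ... | inj₁ e rewrite e = refl
  ... | inj₂ e rewrite e = refl

∑-↭ : {A : Set} {xs ys : List A} (f : A → ℕ) → xs ↭ ys → ∑ xs f ≡ ∑ ys f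
∑-↭ f p = sum-↭ (PermP.map⁺ f p)

∑-tabulate : {A : Set} (n : ℕ) (g : Fin n → A) (f : A → ℕ) →
  ∑ (List.tabulate g) f ≡ ∑ (allFin n) (λ i → f (g i))
∑-tabulate zero g f = refl
∑-tabulate (suc n) g f =
  cong (f (g zero) +_) (trans (∑-tabulate n (λ i → g (suc i)) f) (sym (∑-tabulate n suc (λ i → f (g i)))))

∑-allFin-suc : (n : ℕ) (f : Fin (suc n) → ℕ) → ∑ (allFin (suc n)) f ≡ f zero + ∑ (allFin n) (λ i → f (suc i))
∑-allFin-suc n f = cong (f zero +_) (∑-tabulate n suc f)

∑-allFin-except : (n : ℕ) (k : Fin n) (g h : Fin n → ℕ) → h k ≡ 0 → (∀ j → ¬ (j ≡ k) → h j ≡ g j) →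
  ∑ (allFin n) h + g k ≡ ∑ (allFin n) g
∑-allFin-except (suc n) zero g h hk e = begin
  ∑ (allFin (suc n)) h + g zero                  ≡⟨ cong (_+ g zero) (∑-allFin-suc n h) ⟩
  h zero + ∑ (allFin n) (λ i → h (suc i)) + g zero ≡⟨ cong (λ z → z + ∑ (allFin n) (λ i → h (suc i)) + g zero) hk ⟩
  ∑ (allFin n) (λ i → h (suc i)) + g zero        ≡⟨ +-comm _ (g zero) ⟩
  g zero + ∑ (allFin n) (λ i → h (suc i))        ≡⟨ cong (g zero +_) (∑-cong (allFin n) (λ i → e (suc i) (λ ()))) ⟩
  g zero + ∑ (allFin n) (λ i → g (suc i))        ≡⟨ sym (∑-allFin-suc n g) ⟩
  ∑ (allFin (suc n)) g                           ∎
  where open ≡-Reasoning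
∑-allFin-except (suc n) (suc k) g h hk e = begin
  ∑ (allFin (suc n)) h + g (suc k)                      ≡⟨ cong (_+ g (suc k)) (∑-allFin-suc n h) ⟩
  h zero + ∑ (allFin n) (λ i → h (suc i)) + g (suc k)     ≡⟨ +-assoc (h zero) _ _ ⟩
  h zero + (∑ (allFin n) (λ i → h (suc i)) + g (suc k))   ≡⟨ cong₂ _+_ (e zero (λ ()))
       (∑-allFin-except n k (λ i → g (suc i)) (λ i → h (suc i)) hk
          (λ j j≢k → e (suc j) (λ q → j≢k (FinP.suc-injective q)))) ⟩
  g zero + ∑ (allFin n) (λ i → g (suc i))               ≡⟨ sym (∑-allFin-suc n g) ⟩
  ∑ (allFin (suc n)) g                                  ∎
  where open ≡-Reasoning

eulerStep : ℕ → (ℕ → ℕ) → ℕ → ℕ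
eulerStep n c zero    = c zero
eulerStep n c (suc i) = (2 + i) * c (suc i) + (n ∸ i) * c i

eulerStep-cong : (n : ℕ) {c d : ℕ → ℕ} → (∀ j → c j ≡ d j) → ∀ j → eulerStep n c j ≡ eulerStep n d j
eulerStep-cong n e zero    = e zero
eulerStep-cong n e (suc i) = cong₂ (λ u v → (2 + i) * u + (n ∸ i) * v) (e (suc i)) (e i)

eulerStep-scale : (n k : ℕ) (c : ℕ → ℕ) (j : ℕ) → eulerStep n (λ i → k * c i) j ≡ k * eulerStep n c j
eulerStep-scale n k c zero    = refl
eulerStep-scale n k c (suc i) = lemma (2 + i) (n ∸ i) k (c (suc i)) (c i)
  where
  lemma : ∀ a b k u v → a * (k * u) + b * (k * v) ≡ k * (a * u + b * v)
  lemma = solve-∀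

stepWeight : ℕ → ℕ → ℕ → ℕ
stepWeight n p j = suc p * 𝟙 (p ℕ.≟ j) + (n ∸ p) * 𝟙 (suc p ℕ.≟ j)

stepWeight-zero : (n p : ℕ) → stepWeight n p 0 ≡ 𝟙 (p ℕ.≟ 0)
stepWeight-zero n p = begin
  suc p * 𝟙 (p ℕ.≟ 0) + (n ∸ p) * 0 ≡⟨ cong₂ _+_ (𝟙-subst p 0 suc) (*-zeroʳ (n ∸ p)) ⟩
  1 * 𝟙 (p ℕ.≟ 0) + 0               ≡⟨ trans (+-identityʳ _) (*-identityˡ _) ⟩
  𝟙 (p ℕ.≟ 0)                       ∎
  where open ≡-Reasoning

stepWeight-suc : (n p i : ℕ) → stepWeight n p (suc i) ≡ (2 + i) * 𝟙 (p ℕ.≟ suc i) + (n ∸ i) * 𝟙 (p ℕ.≟ i)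
stepWeight-suc n p i = cong₂ _+_ (𝟙-subst p (suc i) suc)
  (trans (cong ((n ∸ p) *_) (𝟙-suc p i)) (𝟙-subst p i (n ∸_)))

∑-stepWeight : {A : Set} (L : List A) (deg w : A → ℕ) (n j : ℕ) →
  ∑ L (λ a → stepWeight n (deg a) j * w a) ≡ eulerStep n (coeff L deg w) j
∑-stepWeight L deg w n zero =
  trans (∑-cong L (λ a → cong (_* w a) (stepWeight-zero n (deg a)))) (sym (coeff-∑ L deg w 0))
∑-stepWeight L deg w n (suc i) = begin
  ∑ L (λ a → stepWeight n (deg a) (suc i) * w a)
    ≡⟨ ∑-cong L (λ a → trans (cong (_* w a) (stepWeight-suc n (deg a) i))
                              (distrib (2 + i) (n ∸ i) (𝟙 (deg a ℕ.≟ suc i)) (𝟙 (deg a ℕ.≟ i)) (w a))) ⟩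
  ∑ L (λ a → (2 + i) * (𝟙 (deg a ℕ.≟ suc i) * w a) + (n ∸ i) * (𝟙 (deg a ℕ.≟ i) * w a))
    ≡⟨ ∑-+ L _ _ ⟩
  ∑ L (λ a → (2 + i) * (𝟙 (deg a ℕ.≟ suc i) * w a)) + ∑ L (λ a → (n ∸ i) * (𝟙 (deg a ℕ.≟ i) * w a))
    ≡⟨ cong₂ _+_ (∑-* L (2 + i) _) (∑-* L (n ∸ i) _) ⟩
  (2 + i) * ∑ L (λ a → 𝟙 (deg a ℕ.≟ suc i) * w a) + (n ∸ i) * ∑ L (λ a → 𝟙 (deg a ℕ.≟ i) * w a)
    ≡⟨ sym (cong₂ (λ u v → (2 + i) * u + (n ∸ i) * v) (coeff-∑ L deg w (suc i)) (coeff-∑ L deg w i)) ⟩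
  eulerStep n (coeff L deg w) (suc i) ∎
  where
  open ≡-Reasoning
  distrib : ∀ a b x y w → (a * x + b * y) * w ≡ a * (x * w) + b * (y * w)
  distrib = solve-∀

concatMap-map≡cartesianProductWith : {A B C : Set} (f : A → B → C) (xs : List A) (ys : List B) →
  concatMap (λ x → map (f x) ys) xs ≡ cartesianProductWith f xs ys
concatMap-map≡cartesianProductWith f [] ys = refl
concatMap-map≡cartesianProductWith f (x ∷ xs) ys =
  cong (map (f x) ys ++_) (concatMap-map≡cartesianProductWith f xs ys)

allVecs-suc : (m k : ℕ) → allVecs (suc m) k ≡ cartesianProductWith _∷_ (allFin k) (allVecs m k)
allVecs-suc m k = concatMap-map≡cartesianProductWith _∷_ (allFin k) (allVecs m k)

∈-allVecs : {m k : ℕ} (v : Vec (Fin k) m) → v ∈ allVecs m k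
∈-allVecs [] = here refl
∈-allVecs {suc m} {k} (x ∷ v) rewrite allVecs-suc m k = ∈-cartesianProductWith⁺ _∷_ (∈-allFin x) (∈-allVecs v)

unique-allVecs : (m k : ℕ) → Unique (allVecs m k)
unique-allVecs zero k = All.[] AllPairs.∷ AllPairs.[]
unique-allVecs (suc m) k rewrite allVecs-suc m k =
  UniqueP.cartesianProductWith⁺ _∷_ VecP.∷-injective (UniqueP.allFin⁺ k) (unique-allVecs m k)

isPerm? : {n : ℕ} (v : Perm n) → Dec (Unique (toList v))
isPerm? v = UniqueDec.unique? FinP._≟_ (toList v)

unique-Sym : (n : ℕ) → Unique (Sym n)
unique-Sym n = UniqueP.filter⁺ isPerm? (unique-allVecs n n)

toList-as-tabulate : {n : ℕ} {A : Set} (v : Vec A n) → toList v ≡ List.tabulate (lookup v)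
toList-as-tabulate [] = refl
toList-as-tabulate (x ∷ v) = cong (x ∷_) (toList-as-tabulate v)

unique-tabulate⇒injective : {n : ℕ} {A : Set} {f : Fin n → A} → Unique (List.tabulate f) → Injective _≡_ _≡_ f
unique-tabulate⇒injective {suc n} (f0∉ AllPairs.∷ u) {zero}  {zero}  e = refl
unique-tabulate⇒injective {suc n} (f0∉ AllPairs.∷ u) {zero}  {suc j} e = ⊥-elim (AllP.tabulate⁻ f0∉ j e)
unique-tabulate⇒injective {suc n} (f0∉ AllPairs.∷ u) {suc i} {zero}  e = ⊥-elim (AllP.tabulate⁻ f0∉ i (sym e))
unique-tabulate⇒injective {suc n} (f0∉ AllPairs.∷ u) {suc i} {suc j} e = cong suc (unique-tabulate⇒injective u e)

∈-Sym⁺ : {n : ℕ} (v : Perm n) → Injective _≡_ _≡_ (lookup v) → v ∈ Sym n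
∈-Sym⁺ v inj = ∈-filter⁺ isPerm? (∈-allVecs v) (subst Unique (sym (toList-as-tabulate v)) (UniqueP.tabulate⁺ inj))

∈-Sym⁻ : {n : ℕ} (v : Perm n) → v ∈ Sym n → Injective _≡_ _≡_ (lookup v)
∈-Sym⁻ v v∈ = unique-tabulate⇒injective
  (subst Unique (toList-as-tabulate v) (proj₂ (∈-filter⁻ isPerm? {xs = allVecs _ _} v∈)))

vec-ext : {n : ℕ} {A : Set} (u v : Vec A n) → (∀ x → lookup u x ≡ lookup v x) → u ≡ v
vec-ext u v e = trans (sym (VecP.tabulate∘lookup u)) (trans (VecP.tabulate-cong e) (VecP.tabulate∘lookup v))

0≢suc : {n : ℕ} {x : Fin n} → ¬ (zero ≡ suc x)
0≢suc ()

-- Inserting a new point 0 into a map p on {1,…,n} (shifted copy of [n]).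
-- At position zero, 0 becomes a fixed point; at position suc k, 0 is put
-- into the cycle of k+1 just after it:  k+1 ↦ 0 ↦ p(k)+1.
insertZero : {n : ℕ} → (Fin n → Fin n) → Fin (suc n) → Fin (suc n) → Fin (suc n)
insertZero p zero    zero    = zero
insertZero p zero    (suc j) = suc (p j)
insertZero p (suc k) zero    = suc (p k)
insertZero p (suc k) (suc j) with j FinP.≟ k
... | yes _ = zero
... | no _  = suc (p j)

insertZero-hit : {n : ℕ} (p : Fin n → Fin n) (k : Fin n) → insertZero p (suc k) (suc k) ≡ zero
insertZero-hit p k with k FinP.≟ k
... | yes _ = refl
... | no k≢k = ⊥-elim (k≢k refl)

insertZero-miss : {n : ℕ} (p : Fin n → Fin n) (k j : Fin n) → ¬ (j ≡ k) → insertZero p (suc k) (suc j) ≡ suc (p j)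
insertZero-miss p k j j≢k with j FinP.≟ k
... | yes j≡k = ⊥-elim (j≢k j≡k)
... | no _    = refl

insertZero-cong : {n : ℕ} {p q : Fin n → Fin n} → (∀ j → p j ≡ q j) → ∀ i x → insertZero p i x ≡ insertZero q i x
insertZero-cong e zero    zero    = refl
insertZero-cong e zero    (suc j) = cong suc (e j)
insertZero-cong e (suc k) zero    = cong suc (e k)
insertZero-cong e (suc k) (suc j) with j FinP.≟ k
... | yes _ = refl
... | no _  = cong suc (e j)

insertZero-injective : {n : ℕ} (p : Fin n → Fin n) → Injective _≡_ _≡_ p → (i : Fin (suc n)) →
  Injective _≡_ _≡_ (insertZero p i)
insertZero-injective p inj zero    {zero}  {zero}  e = refl
insertZero-injective p inj zero    {zero}  {suc y} e = ⊥-elim (0≢suc e)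
insertZero-injective p inj zero    {suc x} {zero}  e = ⊥-elim (0≢suc (sym e))
insertZero-injective p inj zero    {suc x} {suc y} e = cong suc (inj (FinP.suc-injective e))
insertZero-injective p inj (suc k) {zero}  {zero}  e = refl
insertZero-injective p inj (suc k) {zero}  {suc y} e with y FinP.≟ k
... | yes _   = ⊥-elim (0≢suc (sym e))
... | no y≢k  = ⊥-elim (y≢k (sym (inj (FinP.suc-injective e))))
insertZero-injective p inj (suc k) {suc x} {zero}  e with x FinP.≟ k
... | yes _   = ⊥-elim (0≢suc e)
... | no x≢k  = ⊥-elim (x≢k (inj (FinP.suc-injective e)))
insertZero-injective p inj (suc k) {suc x} {suc y} e with x FinP.≟ k | y FinP.≟ k
... | yes x≡k | yes y≡k = cong suc (trans x≡k (sym y≡k))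
... | yes _   | no _    = ⊥-elim (0≢suc e)
... | no _    | yes _   = ⊥-elim (0≢suc (sym e))
... | no _    | no _    = cong suc (inj (FinP.suc-injective e))

ins : {n : ℕ} → Perm n → Fin (suc n) → Perm (suc n)
ins π i = tabulate (insertZero (lookup π) i)

lookup-ins : {n : ℕ} (π : Perm n) (i x : Fin (suc n)) → lookup (ins π i) x ≡ insertZero (lookup π) i x
lookup-ins π i = VecP.lookup∘tabulate (insertZero (lookup π) i)

ins-injective : {n : ℕ} {π π' : Perm n} {i i' : Fin (suc n)} → ins π i ≡ ins π' i' → π ≡ π' × i ≡ i'
ins-injective {n} {π} {π'} {i} {i'} e = go i i' same
  where
  same : ∀ x → insertZero (lookup π) i x ≡ insertZero (lookup π') i' x
  same x = trans (sym (lookup-ins π i x)) (trans (cong (λ v → lookup v x) e) (lookup-ins π' i' x))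
  go : ∀ i i' → (∀ x → insertZero (lookup π) i x ≡ insertZero (lookup π') i' x) → π ≡ π' × i ≡ i'
  go zero    zero     h = vec-ext π π' (λ j → FinP.suc-injective (h (suc j))) , refl
  go zero    (suc k)  h = ⊥-elim (0≢suc (h zero))
  go (suc k) zero     h = ⊥-elim (0≢suc (sym (h zero)))
  go (suc k) (suc k') h with k FinP.≟ k'
  ... | no k≢k' = ⊥-elim (0≢suc (trans (sym (insertZero-hit (lookup π) k))
                          (trans (h (suc k)) (insertZero-miss (lookup π') k' k k≢k'))))
  ... | yes refl = vec-ext π π' agree , refl
    where
    agree : ∀ j → lookup π j ≡ lookup π' j
    agree j with j FinP.≟ k
    ... | yes refl = FinP.suc-injective (h zero)
    ... | no j≢k = FinP.suc-injective (trans (sym (insertZero-miss (lookup π) k j j≢k))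
                     (trans (h (suc j)) (insertZero-miss (lookup π') k j j≢k)))

predFin : {n : ℕ} (x : Fin (suc n)) → ¬ (x ≡ zero) → Fin n
predFin zero    x≢0 = ⊥-elim (x≢0 refl)
predFin (suc x) x≢0 = x

suc-predFin : {n : ℕ} (x : Fin (suc n)) (x≢0 : ¬ (x ≡ zero)) → suc (predFin x x≢0) ≡ x
suc-predFin zero    x≢0 = ⊥-elim (x≢0 refl)
suc-predFin (suc x) x≢0 = refl

preimage-zero : {n : ℕ} (f : Fin (suc n) → Fin (suc n)) → Injective _≡_ _≡_ f → ∃ λ x → f x ≡ zero
preimage-zero {n} f inj with FinP.any? (λ x → f x FinP.≟ zero)
... | yes found = found
... | no ¬found = ⊥-elim (collision (FinP.pigeonhole (n<1+n n) g))
  where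
  g : Fin (suc n) → Fin n
  g x = predFin (f x) (λ fx≡0 → ¬found (x , fx≡0))
  collision : (∃ λ i → ∃ λ j → (toℕ i < toℕ j) × g i ≡ g j) → ⊥
  collision (i , j , i<j , gi≡gj) = <⇒≢ i<j (cong toℕ (inj
    (trans (sym (suc-predFin (f i) _)) (trans (cong suc gi≡gj) (suc-predFin (f j) _)))))

module RemoveFixedZero {n : ℕ} (f : Fin (suc n) → Fin (suc n)) (inj : Injective _≡_ _≡_ f)
                       (f0 : f zero ≡ zero) where

  nonzero : (j : Fin n) → ¬ (f (suc j) ≡ zero)
  nonzero j e = 0≢suc (inj (trans f0 (sym e)))

  p : Fin n → Fin n
  p j = predFin (f (suc j)) (nonzero j)

  p-injective : Injective _≡_ _≡_ p
  p-injective {j} {j'} e = FinP.suc-injective (inj (trans (sym (suc-predFin (f (suc j)) (nonzero j)))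
    (trans (cong suc e) (suc-predFin (f (suc j')) (nonzero j')))))

  reinsert : ∀ x → insertZero p zero x ≡ f x
  reinsert zero    = sym f0
  reinsert (suc j) = suc-predFin (f (suc j)) (nonzero j)

-- Removing 0 from the cycle  k+1 ↦ 0 ↦ a+1  of f, which becomes  k ↦ a.
module RemoveZeroFromCycle {n : ℕ} (f : Fin (suc n) → Fin (suc n)) (inj : Injective _≡_ _≡_ f)
                           (k : Fin n) (fk : f (suc k) ≡ zero) (a : Fin n) (f0 : f zero ≡ suc a) where

  nonzero : (j : Fin n) → ¬ (j ≡ k) → ¬ (f (suc j) ≡ zero)
  nonzero j j≢k e = j≢k (FinP.suc-injective (inj (trans e (sym fk))))

  p : Fin n → Fin n
  p j with j FinP.≟ k
  ... | yes _   = a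
  ... | no j≢k  = predFin (f (suc j)) (nonzero j j≢k)

  p-hit : p k ≡ a
  p-hit with k FinP.≟ k
  ... | yes _   = refl
  ... | no k≢k  = ⊥-elim (k≢k refl)

  p-miss : (j : Fin n) → ¬ (j ≡ k) → suc (p j) ≡ f (suc j)
  p-miss j j≢k with j FinP.≟ k
  ... | yes j≡k  = ⊥-elim (j≢k j≡k)
  ... | no j≢k'  = suc-predFin (f (suc j)) (nonzero j j≢k')

  p-injective : Injective _≡_ _≡_ p
  p-injective {j} {j'} e = cases (j FinP.≟ k) (j' FinP.≟ k)
    where
    cases : Dec (j ≡ k) → Dec (j' ≡ k) → j ≡ j'
    cases (yes j≡k)  (yes j'≡k) = trans j≡k (sym j'≡k)
    cases (yes refl) (no j'≢k)  = ⊥-elim (0≢suc (inj (trans (trans f0 (cong suc (trans (sym p-hit) e))) (p-miss j' j'≢k))))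
    cases (no j≢k)   (yes refl) = ⊥-elim (0≢suc (inj (trans (trans f0 (cong suc (trans (sym p-hit) (sym e)))) (p-miss j j≢k))))
    cases (no j≢k)   (no j'≢k)  = FinP.suc-injective (inj (trans (sym (p-miss j j≢k)) (trans (cong suc e) (p-miss j' j'≢k))))

  reinsert : ∀ x → insertZero p (suc k) x ≡ f x
  reinsert zero    = trans (cong suc p-hit) (sym f0)
  reinsert (suc j) = cases (j FinP.≟ k)
    where
    cases : Dec (j ≡ k) → insertZero p (suc k) (suc j) ≡ f (suc j)
    cases (yes refl) = trans (insertZero-hit p k) (sym fk)
    cases (no j≢k)   = trans (insertZero-miss p k j j≢k) (p-miss j j≢k)

removeZero : {n : ℕ} (f : Fin (suc n) → Fin (suc n)) → Injective _≡_ _≡_ f →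
  Σ (Fin n → Fin n) λ p → Injective _≡_ _≡_ p × Σ (Fin (suc n)) (λ i → ∀ x → insertZero p i x ≡ f x)
removeZero f inj with f zero in f0
... | zero = let open RemoveFixedZero f inj f0 in p , p-injective , zero , reinsert
... | suc a with preimage-zero f inj
...   | zero  , f0≡0 = ⊥-elim (0≢suc (trans (sym f0≡0) f0))
...   | suc k , fk   = let open RemoveZeroFromCycle f inj k fk a f0 in p , p-injective , suc k , reinsert

insertions : (n : ℕ) → List (Perm (suc n))
insertions n = cartesianProductWith ins (Sym n) (allFin (suc n))

insertions↭Sym : (n : ℕ) → insertions n ↭ Sym (suc n)
insertions↭Sym n = ∼bag⇒↭ (unique∧set⇒bag unique-insertions (unique-Sym (suc n)) (mk⇔ into onto))
  where
  unique-insertions : Unique (insertions n)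
  unique-insertions = UniqueP.cartesianProductWith⁺ ins ins-injective (unique-Sym n) (UniqueP.allFin⁺ (suc n))

  into : {v : Perm (suc n)} → v ∈ insertions n → v ∈ Sym (suc n)
  into v∈ with ∈-cartesianProductWith⁻ ins (Sym n) (allFin (suc n)) v∈
  ... | π , i , π∈ , _ , refl = ∈-Sym⁺ (ins π i) (λ {x} {y} e →
          insertZero-injective (lookup π) (∈-Sym⁻ π π∈) i (trans (sym (lookup-ins π i x)) (trans e (lookup-ins π i y))))

  onto : {v : Perm (suc n)} → v ∈ Sym (suc n) → v ∈ insertions n
  onto {v} v∈ with removeZero (lookup v) (∈-Sym⁻ v v∈)
  ... | p , p-inj , i , reinsert = subst (_∈ insertions n) ins≡v
          (∈-cartesianProductWith⁺ ins (∈-Sym⁺ (tabulate p) π-inj) (∈-allFin i))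
    where
    π-inj : Injective _≡_ _≡_ (lookup (tabulate p))
    π-inj {x} {y} e = p-inj (trans (sym (VecP.lookup∘tabulate p x)) (trans e (VecP.lookup∘tabulate p y)))
    ins≡v : ins (tabulate p) i ≡ v
    ins≡v = vec-ext _ v (λ x → trans (lookup-ins (tabulate p) i x)
              (trans (insertZero-cong (VecP.lookup∘tabulate p) i x) (reinsert x)))

isExc : {n : ℕ} → Perm n → Fin n → ℕ
isExc π i = 𝟙 (toℕ i <? toℕ (lookup π i))

exc-∑ : {n : ℕ} (π : Perm n) → exc π ≡ ∑ (allFin n) (isExc π)
exc-∑ π = length-filter-∑ (λ i → toℕ i <? toℕ (lookup π i)) (allFin _)

isExc-ins : {n : ℕ} (π : Perm n) (i x : Fin (suc n)) →
  isExc (ins π i) x ≡ 𝟙 (toℕ x <? toℕ (insertZero (lookup π) i x))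
isExc-ins π i x = cong (λ y → 𝟙 (toℕ x <? toℕ y)) (lookup-ins π i x)

isExc-shift : {n : ℕ} (j y : Fin n) → 𝟙 (toℕ (suc j) <? toℕ (suc y)) ≡ 𝟙 (toℕ j <? toℕ y)
isExc-shift j y = 𝟙-⇔ _ _ (λ { (s≤s j<y) → j<y }) s≤s

exc-ins-zero : {n : ℕ} (π : Perm n) → exc (ins π zero) ≡ exc π
exc-ins-zero {n} π = begin
  exc (ins π zero)                                    ≡⟨ exc-∑ (ins π zero) ⟩
  ∑ (allFin (suc n)) (isExc (ins π zero))             ≡⟨ ∑-allFin-suc n (isExc (ins π zero)) ⟩
  isExc (ins π zero) zero + ∑ (allFin n) (λ j → isExc (ins π zero) (suc j))
    ≡⟨ cong₂ _+_ (isExc-ins π zero zero)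
                 (∑-cong (allFin n) (λ j → trans (isExc-ins π zero (suc j)) (isExc-shift j (lookup π j)))) ⟩
  ∑ (allFin n) (isExc π)                              ≡⟨ sym (exc-∑ π) ⟩
  exc π                                               ∎
  where open ≡-Reasoning

-- Inserting 0 after k+1 creates the excedance 0 ↦ π(k)+1 and removes the
-- one at k+1 (which now maps to 0), if k was an excedance of π.
exc-ins-suc : {n : ℕ} (π : Perm n) (k : Fin n) → exc (ins π (suc k)) + isExc π k ≡ suc (exc π)
exc-ins-suc {n} π k = begin
  exc (ins π (suc k)) + isExc π k
    ≡⟨ cong (_+ isExc π k) (trans (exc-∑ (ins π (suc k))) (∑-allFin-suc n (isExc (ins π (suc k))))) ⟩
  isExc (ins π (suc k)) zero + ∑ (allFin n) h + isExc π k
    ≡⟨ cong (λ z → z + ∑ (allFin n) h + isExc π k)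
            (trans (isExc-ins π (suc k) zero) (𝟙-yes (0 <? toℕ (suc (lookup π k))) (s≤s z≤n))) ⟩
  suc (∑ (allFin n) h + isExc π k)
    ≡⟨ cong suc (trans (∑-allFin-except n k (isExc π) h h-hit h-miss) (sym (exc-∑ π))) ⟩
  suc (exc π) ∎
  where
  open ≡-Reasoning
  h : Fin n → ℕ
  h j = isExc (ins π (suc k)) (suc j)
  h-hit : h k ≡ 0
  h-hit = trans (isExc-ins π (suc k) (suc k)) (cong (λ y → 𝟙 (suc (toℕ k) <? toℕ y)) (insertZero-hit (lookup π) k))
  h-miss : ∀ j → ¬ (j ≡ k) → h j ≡ isExc π j
  h-miss j j≢k = trans (isExc-ins π (suc k) (suc j))
    (trans (cong (λ y → 𝟙 (suc (toℕ j) <? toℕ y)) (insertZero-miss (lookup π) k j j≢k)) (isExc-shift j (lookup π j)))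

𝟙-split : (E g e k : ℕ) → E + g ≡ suc e → (g ≡ 0) ⊎ (g ≡ 1) →
  𝟙 (E ℕ.≟ k) ≡ 𝟙 (e ℕ.≟ k) * g + 𝟙 (suc e ℕ.≟ k) * (1 ∸ g)
𝟙-split E .0 e k E+0≡ (inj₁ refl) =
  trans (cong (λ x → 𝟙 (x ℕ.≟ k)) (trans (sym (+-identityʳ E)) E+0≡)) (pick-second (𝟙 (e ℕ.≟ k)) _)
  where
  pick-second : ∀ a b → b ≡ a * 0 + b * 1
  pick-second = solve-∀
𝟙-split E .1 e k E+1≡ (inj₂ refl) =
  trans (cong (λ x → 𝟙 (x ℕ.≟ k)) (suc-injective (trans (+-comm 1 E) E+1≡))) (pick-first _ (𝟙 (suc e ℕ.≟ k)))
  where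
  pick-first : ∀ a b → a ≡ a * 1 + b * 0
  pick-first = solve-∀

insertion-profile : {n : ℕ} (π : Perm n) (j : ℕ) →
  ∑ (allFin (suc n)) (λ i → 𝟙 (exc (ins π i) ℕ.≟ j)) ≡ stepWeight n (exc π) j
insertion-profile {n} π j = begin
  ∑ (allFin (suc n)) (λ i → 𝟙 (exc (ins π i) ℕ.≟ j))
    ≡⟨ ∑-allFin-suc n _ ⟩
  𝟙 (exc (ins π zero) ℕ.≟ j) + ∑ (allFin n) (λ k → 𝟙 (exc (ins π (suc k)) ℕ.≟ j))
    ≡⟨ cong₂ _+_ (cong (λ x → 𝟙 (x ℕ.≟ j)) (exc-ins-zero π))
                 (∑-cong (allFin n) (λ k → 𝟙-split _ (isExc π k) e j (exc-ins-suc π k) (𝟙-01 _))) ⟩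
  c₁ + ∑ (allFin n) (λ k → c₁ * isExc π k + c₂ * (1 ∸ isExc π k))
    ≡⟨ cong (c₁ +_) (trans (∑-+ (allFin n) _ _) (cong₂ _+_ (∑-* (allFin n) c₁ _) (∑-* (allFin n) c₂ _))) ⟩
  c₁ + (c₁ * ∑ (allFin n) (isExc π) + c₂ * ∑ (allFin n) (λ k → 1 ∸ isExc π k))
    ≡⟨ cong₂ (λ u v → c₁ + (c₁ * u + c₂ * v)) (sym (exc-∑ π))
         (trans (∑-complement (allFin n) (isExc π) (λ k → 𝟙-01 _))
                (cong₂ _∸_ (length-tabulate {n = n} (λ i → i)) (sym (exc-∑ π)))) ⟩
  c₁ + (c₁ * e + c₂ * (n ∸ e))
    ≡⟨ regroup c₁ e c₂ (n ∸ e) ⟩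
  stepWeight n e j ∎
  where
  open ≡-Reasoning
  e  = exc π
  c₁ = 𝟙 (e ℕ.≟ j)
  c₂ = 𝟙 (suc e ℕ.≟ j)
  regroup : ∀ c e d m → c + (c * e + d * m) ≡ suc e * c + m * d
  regroup = solve-∀

euler-recurrence : (n j : ℕ) → eulerianCoeff (suc n) j ≡ eulerStep n (eulerianCoeff n) j
euler-recurrence n j = begin
  eulerianCoeff (suc n) j
    ≡⟨ coeff-∑ (Sym (suc n)) exc (λ _ → 1) j ⟩
  ∑ (Sym (suc n)) w
    ≡⟨ sym (∑-↭ w (insertions↭Sym n)) ⟩
  ∑ (insertions n) w
    ≡⟨ ∑-cartesianProductWith ins (Sym n) (allFin (suc n)) w ⟩
  ∑ (Sym n) (λ π → ∑ (allFin (suc n)) (λ i → w (ins π i)))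
    ≡⟨ ∑-cong (Sym n) (λ π → trans (∑-cong (allFin (suc n)) (λ i → *-identityʳ _))
                                   (trans (insertion-profile π j) (sym (*-identityʳ _)))) ⟩
  ∑ (Sym n) (λ π → stepWeight n (exc π) j * 1)
    ≡⟨ ∑-stepWeight (Sym n) exc (λ _ → 1) n j ⟩
  eulerStep n (eulerianCoeff n) j ∎
  where
  open ≡-Reasoning
  w : Perm (suc n) → ℕ
  w v = 𝟙 (exc v ℕ.≟ j) * 1

∑-snoc : (f : Entry → ℕ) (Y : List Entry) (y : Entry) → ∑ (Y ++ [ y ]) f ≡ ∑ Y f + f y
∑-snoc f [] y = +-identityʳ (f y)
∑-snoc f (x ∷ Y) y = trans (cong (f x +_) (∑-snoc f Y y)) (sym (+-assoc (f x) _ _))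

-- The allowed values after Y: 2(1+s) positive entries, 2t negative entries and
-- one ⋆ (s = neg Y + star Y - 1, t = pos Y).
∑-allowed : (Y : List Entry) (g : ℕ → ℕ → ℕ) →
  ∑ (allowed Y) (λ y → g (posE y) (starE y))
    ≡ 2 * (1 + (neg Y + star Y ∸ 1)) * g 1 0 + (2 * pos Y * g 0 0 + g 0 1)
∑-allowed Y g = begin
  ∑ (allowed Y) G
    ≡⟨ ∑-++ (P a) (N t) G ⟩
  ∑ (P a) G + ∑ (N t) G
    ≡⟨ cong (∑ (P a) G +_) (∑-++ (map (λ i → num (ℤ⁻ i)) (upTo (2 * t))) [ ⋆ ] G) ⟩
  ∑ (P a) G + (∑ (map (λ i → num (ℤ⁻ i)) (upTo (2 * t))) G + (g 0 1 + 0))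
    ≡⟨ cong₂ (λ u v → u + (v + (g 0 1 + 0))) (count (2 * a) (λ i → num (ℤ⁺ (suc i))) (g 1 0) (λ _ → refl))
                                              (count (2 * t) (λ i → num (ℤ⁻ i)) (g 0 0) (λ _ → refl)) ⟩
  2 * a * g 1 0 + (2 * t * g 0 0 + (g 0 1 + 0))
    ≡⟨ cong (λ z → 2 * a * g 1 0 + (2 * t * g 0 0 + z)) (+-identityʳ (g 0 1)) ⟩
  2 * a * g 1 0 + (2 * t * g 0 0 + g 0 1) ∎
  where
  open ≡-Reasoning
  a = 1 + (neg Y + star Y ∸ 1)
  t = pos Y
  G : Entry → ℕ
  G y = g (posE y) (starE y)
  count : (k : ℕ) (entry : ℕ → Entry) (c : ℕ) → (∀ i → G (entry i) ≡ c) → ∑ (map entry (upTo k)) G ≡ k * c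
  count k entry c same = trans (∑-map entry (upTo k) G)
    (trans (∑-cong (upTo k) same) (trans (∑-const (upTo k) c) (cong (_* c) (length-upTo k))))

-- Every sequence in 𝒴_{m+1} has m+1 entries, each positive, negative or ⋆,
-- and contains at least one ⋆ (its first entry).
MYInvariant : ℕ → List Entry → Set
MYInvariant m Y = (pos Y + (neg Y + star Y) ≡ suc m) × (1 ≤ star Y)

kindCount : Entry → ℕ
kindCount y = posE y + (negE y + starE y)

allowed-kind : (Y : List Entry) → All (λ y → kindCount y ≡ 1) (allowed Y)
allowed-kind Y =
  AllP.++⁺ (AllP.map⁺ {f = λ i → num (ℤ⁺ (suc i))}
              (All.universal (λ _ → refl) (upTo (2 * (1 + (neg Y + star Y ∸ 1))))))
  (AllP.++⁺ (AllP.map⁺ {f = λ i → num (ℤ⁻ i)} (All.universal (λ _ → refl) (upTo (2 * pos Y))))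
            (refl ∷ []))

MYInvariant-snoc : {m : ℕ} {Y : List Entry} {y : Entry} → MYInvariant m Y → kindCount y ≡ 1 →
  MYInvariant (suc m) (Y ++ [ y ])
MYInvariant-snoc {m} {Y} {y} (size , ⋆∈Y) kindCount≡1
  rewrite ∑-snoc posE Y y | ∑-snoc negE Y y | ∑-snoc starE Y y =
  trans (regroup (pos Y) (neg Y) (star Y) (posE y) (negE y) (starE y))
        (trans (cong₂ _+_ size kindCount≡1) (+-comm (suc m) 1)) ,
  ≤-trans ⋆∈Y (m≤m+n (star Y) (starE y))
  where
  regroup : ∀ p q s a b c → p + a + ((q + b) + (s + c)) ≡ (p + (q + s)) + (a + (b + c))
  regroup = solve-∀

MY-invariant : (m : ℕ) → All (MYInvariant m) (MY (suc m))
MY-invariant zero    = (refl , s≤s z≤n) ∷ []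
MY-invariant (suc m) = AllP.concat⁺ (AllP.map⁺ (All.map extend (MY-invariant m)))
  where
  extend : {Y : List Entry} → MYInvariant m Y → All (MYInvariant (suc m)) (map (λ y → Y ++ [ y ]) (allowed Y))
  extend {Y} inv = AllP.map⁺ (All.map (λ {y} → MYInvariant-snoc {m} {Y} {y} inv) (allowed-kind Y))

positive-choices : (m : ℕ) (Y : List Entry) → MYInvariant m Y → 1 + (neg Y + star Y ∸ 1) ≡ suc m ∸ pos Y
positive-choices m Y (size , ⋆∈Y) =
  trans (m+[n∸m]≡n {1} {neg Y + star Y} (≤-trans ⋆∈Y (m≤n+m (star Y) (neg Y))))
        (trans (sym (m+n∸m≡n (pos Y) (neg Y + star Y))) (cong (_∸ pos Y) size))

-- The weighted extensions of Y ∈ 𝒴_{m+1} have twice the Eulerian profile: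
-- 2(m+1-p) raise pos by one, 2p keep it, and ⋆ keeps it but doubles the weight.
extension-profile : (m : ℕ) (Y : List Entry) (j : ℕ) → MYInvariant m Y →
  ∑ (allowed Y) (λ y → 𝟙 (pos (Y ++ [ y ]) ℕ.≟ j) * 2 ^ star (Y ++ [ y ]))
    ≡ 2 * (stepWeight (suc m) (pos Y) j * 2 ^ star Y)
extension-profile m Y j inv = begin
  ∑ (allowed Y) (λ y → 𝟙 (pos (Y ++ [ y ]) ℕ.≟ j) * 2 ^ star (Y ++ [ y ]))
    ≡⟨ ∑-cong (allowed Y) (λ y → cong₂ (λ u v → 𝟙 (u ℕ.≟ j) * 2 ^ v) (∑-snoc posE Y y) (∑-snoc starE Y y)) ⟩
  ∑ (allowed Y) (λ y → 𝟙 (p + posE y ℕ.≟ j) * 2 ^ (s + starE y))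
    ≡⟨ ∑-allowed Y (λ u v → 𝟙 (p + u ℕ.≟ j) * 2 ^ (s + v)) ⟩
  2 * a * (𝟙 (p + 1 ℕ.≟ j) * 2 ^ (s + 0))
    + (2 * p * (𝟙 (p + 0 ℕ.≟ j) * 2 ^ (s + 0)) + 𝟙 (p + 0 ℕ.≟ j) * 2 ^ (s + 1))
    ≡⟨ cong₂ (λ u v → 2 * a * (𝟙 (u ℕ.≟ j) * 2 ^ (s + 0))
                      + (2 * p * (𝟙 (v ℕ.≟ j) * 2 ^ (s + 0)) + 𝟙 (v ℕ.≟ j) * 2 ^ (s + 1)))
             (+-comm p 1) (+-identityʳ p) ⟩
  2 * a * (X * 2 ^ (s + 0)) + (2 * p * (Z * 2 ^ (s + 0)) + Z * 2 ^ (s + 1))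
    ≡⟨ cong₂ (λ u v → 2 * a * (X * u) + (2 * p * (Z * u) + Z * v)) (^-distribˡ-+-* 2 s 0) (^-distribˡ-+-* 2 s 1) ⟩
  2 * a * (X * (2 ^ s * 1)) + (2 * p * (Z * (2 ^ s * 1)) + Z * (2 ^ s * 2))
    ≡⟨ regroup a p X Z (2 ^ s) ⟩
  2 * ((suc p * Z + a * X) * 2 ^ s)
    ≡⟨ cong (λ b → 2 * ((suc p * Z + b * X) * 2 ^ s)) (positive-choices m Y inv) ⟩
  2 * (stepWeight (suc m) p j * 2 ^ s) ∎
  where
  open ≡-Reasoning
  p = pos Y
  s = star Y
  a = 1 + (neg Y + star Y ∸ 1)
  X = 𝟙 (suc p ℕ.≟ j)
  Z = 𝟙 (p ℕ.≟ j)
  regroup : ∀ a p X Z t → 2 * a * (X * (t * 1)) + (2 * p * (Z * (t * 1)) + Z * (t * 2)) ≡ 2 * ((suc p * Z + a * X) * t)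
  regroup = solve-∀

myCoeff : ℕ → ℕ → ℕ
myCoeff n = coeff (MY n) pos (λ Y → 2 ^ star Y)

MY-recurrence : (m j : ℕ) → myCoeff (suc (suc m)) j ≡ 2 * eulerStep (suc m) (myCoeff (suc m)) j
MY-recurrence m j = begin
  myCoeff (suc (suc m)) j
    ≡⟨ coeff-∑ (MY (suc (suc m))) pos w j ⟩
  ∑ (concatMap extensions (MY (suc m))) F
    ≡⟨ ∑-concatMap extensions (MY (suc m)) F ⟩
  ∑ (MY (suc m)) (λ Y → ∑ (extensions Y) F)
    ≡⟨ ∑-cong (MY (suc m)) (λ Y → ∑-map (λ y → Y ++ [ y ]) (allowed Y) F) ⟩
  ∑ (MY (suc m)) (λ Y → ∑ (allowed Y) (λ y → F (Y ++ [ y ])))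
    ≡⟨ ∑-congAll (All.map (λ {Y} inv → extension-profile m Y j inv) (MY-invariant m)) ⟩
  ∑ (MY (suc m)) (λ Y → 2 * (stepWeight (suc m) (pos Y) j * w Y))
    ≡⟨ ∑-* (MY (suc m)) 2 _ ⟩
  2 * ∑ (MY (suc m)) (λ Y → stepWeight (suc m) (pos Y) j * w Y)
    ≡⟨ cong (2 *_) (∑-stepWeight (MY (suc m)) pos w (suc m) j) ⟩
  2 * eulerStep (suc m) (myCoeff (suc m)) j ∎
  where
  open ≡-Reasoning
  w : List Entry → ℕ
  w Y = 2 ^ star Y
  F : List Entry → ℕ
  F Y = 𝟙 (pos Y ℕ.≟ j) * w Y
  extensions : List Entry → List (List Entry)
  extensions Y = map (λ y → Y ++ [ y ]) (allowed Y)

scaled-euler≡MY : (n j : ℕ) → 2 ^ suc n * eulerianCoeff (suc n) j ≡ myCoeff (suc n) j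
scaled-euler≡MY zero zero    = refl
scaled-euler≡MY zero (suc j) = refl
scaled-euler≡MY (suc m) j = begin
  2 ^ suc (suc m) * eulerianCoeff (suc (suc m)) j
    ≡⟨ cong (2 ^ suc (suc m) *_) (euler-recurrence (suc m) j) ⟩
  2 * 2 ^ suc m * eulerStep (suc m) (eulerianCoeff (suc m)) j
    ≡⟨ *-assoc 2 (2 ^ suc m) _ ⟩
  2 * (2 ^ suc m * eulerStep (suc m) (eulerianCoeff (suc m)) j)
    ≡⟨ cong (2 *_) (sym (eulerStep-scale (suc m) (2 ^ suc m) (eulerianCoeff (suc m)) j)) ⟩
  2 * eulerStep (suc m) (λ i → 2 ^ suc m * eulerianCoeff (suc m) i) j
    ≡⟨ cong (2 *_) (eulerStep-cong (suc m) (scaled-euler≡MY m) j) ⟩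
  2 * eulerStep (suc m) (myCoeff (suc m)) j
    ≡⟨ sym (MY-recurrence m j) ⟩
  myCoeff (suc (suc m)) j ∎
  where open ≡-Reasoning

corollary1 : (n : ℕ) → 1 ≤ n → (j : ℕ) →
    2 ^ n * eulerianCoeff n j ≡ coeff (MY n) pos (λ Y → 2 ^ star Y) j
corollary1 (suc n) _ j = scaled-euler≡MY n j
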